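{- Let $k\ge 3$. If $\mathcal{G}$ is a (non-degenerate) $[n,k,d]_q$ A$^s$MDS code with $n=(s+1)(q+1)+k-2$, then for each $0\le j\le k-2$ the number \[ \gamma_j=\frac{\binom{n-j}{k-1-j}}{\binom{n-d-j}{k-1-j}} \] is an integer.
   Context: A linear $[n,k,d]_q$ code is identified with a projective system: a finite multiset $\mathcal{G}$ of $n$ points (counted with multiplicity) of $\mathrm{PG}(k-1,q)$, not all lying in one hyperplane, with $n-d=\max_H|\mathcal{G}\cap H|$ over hyperplanes $H$ (counted with multiplicity). The Singleton defect is $n-k+1-d$; the code is A$^s$MDS if its defect is $s$. -}

module Defs where

open import Data.Nat using (ℕ; zero; suc; _+_)
open import Data.Fin using (Fin)
open import Data.Fin.Properties using (_≟_)
open import Data.Product using (Σ; _×_; ∃; _,_)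
import Data.Nat
open import Relation.Nullary using (¬_; yes; no)
open import Relation.Binary.PropositionalEquality using (_≡_)
open import Algebra.Structures using (IsCommutativeRing)

record FiniteField (q : ℕ) : Set where
  field
    _+F_ _*F_ : Fin q → Fin q → Fin q
    -F_       : Fin q → Fin q
    0F 1F     : Fin q
    isCommutativeRing : IsCommutativeRing _≡_ _+F_ _*F_ -F_ 0F 1F
    0≢1       : ¬ (0F ≡ 1F)
    inverse   : ∀ x → ¬ (x ≡ 0F) → Σ (Fin q) (λ y → x *F y ≡ 1F)

module _ {q : ℕ} (F : FiniteField q) where
  open FiniteField F

  ΣF : (m : ℕ) → (Fin m → Fin q) → Fin q
  ΣF zero    f = 0F
  ΣF (suc m) f = f Fin.zero +F ΣF m (λ i → f (Fin.suc i))

  dot : {k : ℕ} → (Fin k → Fin q) → (Fin k → Fin q) → Fin q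
  dot {k} u x = ΣF k (λ i → u i *F x i)

  NonZeroVec : {k : ℕ} → (Fin k → Fin q) → Set
  NonZeroVec {k} x = ¬ (∀ i → x i ≡ 0F)

  -- A projective system of n points of PG(k-1,q), counted with multiplicity:
  -- each point is given by a nonzero representative vector in F_q^k.
  ProjSystem : (n k : ℕ) → Set
  ProjSystem n k = Σ (Fin n → Fin k → Fin q) (λ G → ∀ i → NonZeroVec (G i))

  hypCount : {n k : ℕ} → (Fin n → Fin k → Fin q) → (Fin k → Fin q) → ℕ
  hypCount {zero}  G u = 0
  hypCount {suc n} G u with dot u (G Fin.zero) ≟ 0F
  ... | yes _ = suc (hypCount (λ i → G (Fin.suc i)) u)
  ... | no  _ = hypCount (λ i → G (Fin.suc i)) u

  NonDegenerate : {n k : ℕ} → ProjSystem n k → Set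
  NonDegenerate {n} {k} (G , _) =
    ∀ (u : Fin k → Fin q) → NonZeroVec u → ¬ (hypCount G u ≡ n)

  -- n - d = max over hyperplanes of |G ∩ H|
  HasMinDist : {n k : ℕ} → ProjSystem n k → ℕ → Set
  HasMinDist {n} {k} (G , _) d =
    (∀ (u : Fin k → Fin q) → NonZeroVec u → hypCount G u + d Data.Nat.≤ n)
    × Σ (Fin k → Fin q) (λ u → NonZeroVec u × hypCount G u + d ≡ n)

{-# OPTIONS --safe #-}
module Submission where

-- Write k = t + 2 and a = n - d for the largest number of points of G on a hyperplane; the
-- hypotheses give a = t + s + 1, i.e. (q + 1) a = n + q t.  Counting the points of G on the
-- q + 1 hyperplanes of a pencil then shows that two distinct hyperplanes share at most t
-- points, and share t only if both are maximal (carry a points).  So the normals of the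
-- hyperplanes through t distinct points of G form a plane, all of whose q + 1 hyperplanes are
-- maximal.  Counting pairs (H, P) with H a maximal hyperplane through a set L of l distinct
-- points and P a point of H outside L gives γ(L) (a - l) = Σ_{P ∉ L} γ(L ∪ {P}), where γ(L)
-- is the number of maximal hyperplanes through L; downward induction on l from l = t, where
-- γ = q + 1, yields γ(L) C(a - l, t + 1 - l) = C(n - l, t + 1 - l).

open import Defs
open import Algebra.Bundles using (CommutativeRing)
import Algebra.Properties.Group as GroupProperties
import Algebra.Properties.CommutativeSemigroup as CommutativeSemigroupProperties
open import Data.Bool.Base using (if_then_else_)
open import Data.Empty using (⊥-elim)
open import Data.Fin.Base using (Fin; zero; suc)
open import Data.Fin.Permutation using (permutation)
open import Data.Fin.Properties using (_≟_)
open import Data.List.Base using (List; []; _∷_; length)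
open import Data.Nat.Base using (ℕ; zero; suc; _+_; _*_; _∸_; _^_; _≤_; _<_; z≤n; s≤s; NonZero; >-nonZero)
open import Data.Nat.Combinatorics using (_C_; nC1≡n; nCk+nC[k+1]≡[n+1]C[k+1])
open import Data.Nat.Divisibility using (_∣_; divides)
open import Data.Nat.Properties hiding (_≟_)
open import Data.Nat.Properties using () renaming (_≟_ to _≟ℕ_)
open import Data.Nat.Tactic.RingSolver using (solve-∀)
open import Data.Product.Base using (∃; _×_; _,_; proj₁; proj₂)
open import Data.Sum.Base using (inj₁; inj₂)
open import Data.Vec.Functional using (Vector; tail) renaming (_∷_ to _∷ᵥ_)
open import Function.Base using (_∘_)
open import Level using (Level; 0ℓ)
open import Relation.Nullary.Decidable.Core using (Dec; yes; no; isYes)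
open import Relation.Nullary.Negation.Core using (¬_)
open import Relation.Binary.PropositionalEquality
open import Algebra.Properties.Semiring.Sum +-*-semiring
  using (sum; sum-syntax; sum-cong-≗; ∑-distrib-+; ∑-comm; ∑-permute; *-distribˡ-sum; *-distribʳ-sum)

private
  variable
    m n k : ℕ
    p r : Level
    P : Set p
    Q : Set r

𝟙 : Dec P → ℕ
𝟙 d = if isYes d then 1 else 0

𝟙≤1 : (d : Dec P) → 𝟙 d ≤ 1
𝟙≤1 (yes _) = ≤-refl
𝟙≤1 (no _)  = z≤n

𝟙-yes : (d : Dec P) → P → 𝟙 d ≡ 1
𝟙-yes (yes _) _  = refl
𝟙-yes (no ¬x) x = ⊥-elim (¬x x)

𝟙-no : (d : Dec P) → ¬ P → 𝟙 d ≡ 0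
𝟙-no (yes x) ¬x = ⊥-elim (¬x x)
𝟙-no (no _)  _  = refl

𝟙>0⇒ : (d : Dec P) → 0 < 𝟙 d → P
𝟙>0⇒ (yes x) _ = x

𝟙-cong : (d : Dec P) (e : Dec Q) → (P → Q) → (Q → P) → 𝟙 d ≡ 𝟙 e
𝟙-cong (yes x) e f _ = sym (𝟙-yes e (f x))
𝟙-cong (no ¬x) e _ g = sym (𝟙-no e (¬x ∘ g))

*>0⇒ : ∀ x y → 0 < x * y → 0 < x × 0 < y
*>0⇒ (suc x) (suc y) _ = s≤s z≤n , s≤s z≤n
*>0⇒ (suc x) zero    p = ⊥-elim (<-irrefl (sym (*-zeroʳ x)) p)

≤1∧>0⇒≡1 : ∀ {x} → x ≤ 1 → 0 < x → x ≡ 1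
≤1∧>0⇒≡1 (s≤s z≤n) _ = refl

*-congˡ-if>0 : ∀ x {y z} → (0 < x → y ≡ z) → x * y ≡ x * z
*-congˡ-if>0 zero    _   = refl
*-congˡ-if>0 (suc x) y≡z = cong (suc x *_) (y≡z (s≤s z≤n))

sum-const : ∀ m c → ∑[ i < m ] c ≡ m * c
sum-const zero    c = refl
sum-const (suc m) c = cong (c +_) (sum-const m c)

sum-mono-≤ : {f g : Fin m → ℕ} → (∀ i → f i ≤ g i) → sum f ≤ sum g
sum-mono-≤ {zero}  f≤g = z≤n
sum-mono-≤ {suc m} f≤g = +-mono-≤ (f≤g zero) (sum-mono-≤ (f≤g ∘ suc))

sum-*ˡ : ∀ c (f : Fin m → ℕ) → ∑[ i < m ] (c * f i) ≡ c * sum f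
sum-*ˡ c f = sym (*-distribˡ-sum c f)

sum-if-≟ : (c : Fin m) (x y : ℕ) → ∑[ i < m ] (if isYes (i ≟ c) then x else y) ≡ x + (m ∸ 1) * y
sum-if-≟ {suc m} zero x y =
  cong (x +_) (sum-const m y)
sum-if-≟ {suc (suc m)} (suc c) x y = begin
  y + ∑[ i < suc m ] (if isYes (suc i ≟ suc c) then x else y)
    ≡⟨ cong (y +_) (trans (sum-cong-≗ shift) (sum-if-≟ c x y)) ⟩
  y + (x + m * y) ≡⟨ x∙yz≈y∙xz y x (m * y) ⟩
  x + suc m * y   ∎
  where
  open ≡-Reasoning
  open CommutativeSemigroupProperties +-commutativeSemigroup using (x∙yz≈y∙xz)
  shift : ∀ i → (if isYes (suc i ≟ suc c) then x else y) ≡ (if isYes (i ≟ c) then x else y)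
  shift i with i ≟ c
  ... | yes _ = refl
  ... | no _  = refl

sum-𝟙-≟ : (c : Fin m) → ∑[ i < m ] 𝟙 (i ≟ c) ≡ 1
sum-𝟙-≟ {m} c = trans (sum-if-≟ c 1 0) (cong suc (*-zeroʳ (m ∸ 1)))

sum>0⇒∃ : (f : Fin m → ℕ) → 0 < sum f → ∃ λ i → 0 < f i
sum>0⇒∃ {suc m} f p with f zero in eq
... | suc _ = zero , subst (0 <_) (sym eq) (s≤s z≤n)
... | zero  = let (i , fi>0) = sum>0⇒∃ (f ∘ suc) p in suc i , fi>0

sum≡0⇒≡0 : (f : Fin m → ℕ) → sum f ≡ 0 → ∀ i → f i ≡ 0
sum≡0⇒≡0 f eq zero    = m+n≡0⇒m≡0 (f zero) eq
sum≡0⇒≡0 f eq (suc i) = sum≡0⇒≡0 (f ∘ suc) (m+n≡0⇒n≡0 (f zero) eq) i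

sum<m⇒∃≡0 : (f : Fin m → ℕ) → sum f < m → ∃ λ i → f i ≡ 0
sum<m⇒∃≡0 {suc m} f p with f zero in eq
... | zero  = zero , eq
... | suc x = let (i , fi≡0) = sum<m⇒∃≡0 (f ∘ suc) (+-cancelˡ-< (suc x) _ _ (≤-trans p (s≤s (m≤n+m m x))))
              in suc i , fi≡0

sum-reindex : (f : Fin m → ℕ) (φ ψ : Fin m → Fin m) → (∀ x → φ (ψ x) ≡ x) → (∀ x → ψ (φ x) ≡ x) →
              ∑[ i < m ] f (φ i) ≡ sum f
sum-reindex f φ ψ φψ ψφ = sym (∑-permute f (permutation φ ψ φψ ψφ))


q²≡1+[q∸1]*n⇒n≡1+q : ∀ q n → 2 ≤ q → q * q ≡ 1 + (q ∸ 1) * n → n ≡ 1 + q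
q²≡1+[q∸1]*n⇒n≡1+q (suc zero)      n (s≤s ()) eq
q²≡1+[q∸1]*n⇒n≡1+q (suc p@(suc _)) n _ eq =
  *-cancelˡ-≡ n (suc (suc p)) p (sym (trans (*-suc p (suc p)) (suc-injective eq)))

C-absorption : ∀ n k → suc k * (suc n C suc k) ≡ suc n * (n C k)
C-absorption zero    zero    = refl
C-absorption zero    (suc k) = *-zeroʳ (suc (suc k))
C-absorption (suc n) zero    = trans (+-identityʳ _) (trans (nC1≡n (suc (suc n))) (sym (*-identityʳ _)))
C-absorption (suc n) (suc k) = begin
  suc (suc k) * (suc (suc n) C suc (suc k))
    ≡⟨ cong (suc (suc k) *_) (nCk+nC[k+1]≡[n+1]C[k+1] (suc n) (suc k)) ⟨
  suc (suc k) * (suc n C suc k + suc n C suc (suc k))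
    ≡⟨ *-distribˡ-+ (suc (suc k)) (suc n C suc k) _ ⟩
  suc n C suc k + suc k * (suc n C suc k) + suc (suc k) * (suc n C suc (suc k))
    ≡⟨ cong₂ (λ x y → suc n C suc k + x + y) (C-absorption n k) (C-absorption n (suc k)) ⟩
  suc n C suc k + suc n * (n C k) + suc n * (n C suc k)
    ≡⟨ +-assoc (suc n C suc k) _ _ ⟩
  suc n C suc k + (suc n * (n C k) + suc n * (n C suc k))
    ≡⟨ cong (suc n C suc k +_) (*-distribˡ-+ (suc n) (n C k) _) ⟨
  suc n C suc k + suc n * (n C k + n C suc k)
    ≡⟨ cong (λ x → suc n C suc k + suc n * x) (nCk+nC[k+1]≡[n+1]C[k+1] n k) ⟩
  suc (suc n) * (suc n C suc k) ∎
  where open ≡-Reasoning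

C-absorption-∸ : ∀ {ℓ m} k → ℓ < m → suc k * ((m ∸ ℓ) C suc k) ≡ (m ∸ ℓ) * ((m ∸ suc ℓ) C k)
C-absorption-∸ {ℓ} {m} k ℓ<m = begin
  suc k * ((m ∸ ℓ) C suc k)           ≡⟨ cong (λ x → suc k * (x C suc k)) m∸ℓ ⟩
  suc k * (suc (m ∸ suc ℓ) C suc k)   ≡⟨ C-absorption (m ∸ suc ℓ) k ⟩
  suc (m ∸ suc ℓ) * ((m ∸ suc ℓ) C k) ≡⟨ cong (_* ((m ∸ suc ℓ) C k)) m∸ℓ ⟨
  (m ∸ ℓ) * ((m ∸ suc ℓ) C k)         ∎
  where
  open ≡-Reasoning
  m∸ℓ : m ∸ ℓ ≡ suc (m ∸ suc ℓ)
  m∸ℓ = +-∸-assoc 1 ℓ<m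

[1+q]*[a∸t]≡n∸t : ∀ q a n t → a + q * a ≡ n + q * t → suc q * (a ∸ t) ≡ n ∸ t
[1+q]*[a∸t]≡n∸t q a n t balance = begin
  suc q * (a ∸ t)             ≡⟨ *-distribˡ-∸ (suc q) a t ⟩
  (a + q * a) ∸ (t + q * t)   ≡⟨ cong₂ _∸_ (trans balance (+-comm n (q * t))) (+-comm t (q * t)) ⟩
  (q * t + n) ∸ (q * t + t)   ≡⟨ [m+n]∸[m+o]≡n∸o (q * t) n t ⟩
  n ∸ t                       ∎
  where open ≡-Reasoning

distinct⇒2≤ : {x y : Fin m} → ¬ x ≡ y → 2 ≤ m
distinct⇒2≤ {suc zero}    {zero} {zero} x≢y = ⊥-elim (x≢y refl)
distinct⇒2≤ {suc (suc _)} _                 = s≤s (s≤s z≤n)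

occurrences : Fin n → List (Fin n) → ℕ
occurrences j []      = 0
occurrences j (i ∷ L) = 𝟙 (j ≟ i) + occurrences j L

Distinct : List (Fin n) → Set
Distinct L = ∀ j → occurrences j L ≤ 1

∑-occurrences : (L : List (Fin n)) → ∑[ j < n ] occurrences j L ≡ length L
∑-occurrences {n} []      = trans (sum-const n 0) (*-zeroʳ n)
∑-occurrences {n} (i ∷ L) = begin
  ∑[ j < n ] (𝟙 (j ≟ i) + occurrences j L)
    ≡⟨ ∑-distrib-+ (λ j → 𝟙 (j ≟ i)) (λ j → occurrences j L) ⟩
  ∑[ j < n ] 𝟙 (j ≟ i) + ∑[ j < n ] occurrences j L
    ≡⟨ cong₂ _+_ (sum-𝟙-≟ i) (∑-occurrences L) ⟩
  suc (length L) ∎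
  where open ≡-Reasoning

fresh : (L : List (Fin n)) → length L < n → ∃ λ i → occurrences i L ≡ 0
fresh {n} L L<n = sum<m⇒∃≡0 (λ j → occurrences j L) (subst (_< n) (sym (∑-occurrences L)) L<n)

Distinct-∷ : {L : List (Fin n)} {i : Fin n} → Distinct L → occurrences i L ≡ 0 → Distinct (i ∷ L)
Distinct-∷ {i = i} L-distinct i∉L j with j ≟ i
... | yes refl = ≤-reflexive (cong suc i∉L)
... | no _     = L-distinct j

∑-complement : (L : List (Fin n)) → Distinct L → ∑[ j < n ] (1 ∸ occurrences j L) ≡ n ∸ length L
∑-complement {n} L L-distinct = begin
  ∑[ j < n ] (1 ∸ occurrences j L)
    ≡⟨ m+n∸n≡m _ (length L) ⟨
  ∑[ j < n ] (1 ∸ occurrences j L) + length L ∸ length L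
    ≡⟨ cong (λ ℓ → ∑[ j < n ] (1 ∸ occurrences j L) + ℓ ∸ length L) (∑-occurrences L) ⟨
  ∑[ j < n ] (1 ∸ occurrences j L) + ∑[ j < n ] occurrences j L ∸ length L
    ≡⟨ cong (_∸ length L) (∑-distrib-+ (λ j → 1 ∸ occurrences j L) (λ j → occurrences j L)) ⟨
  ∑[ j < n ] (1 ∸ occurrences j L + occurrences j L) ∸ length L
    ≡⟨ cong (_∸ length L) (sum-cong-≗ {n} (λ j → m∸n+n≡m (L-distinct j))) ⟩
  ∑[ j < n ] 1 ∸ length L
    ≡⟨ cong (_∸ length L) (trans (sum-const n 1) (*-identityʳ n)) ⟩
  n ∸ length L ∎
  where open ≡-Reasoning

distinctOfLength : ∀ ℓ → ℓ ≤ n → ∃ λ (L : List (Fin n)) → Distinct L × length L ≡ ℓ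
distinctOfLength zero    _   = [] , (λ _ → z≤n) , refl
distinctOfLength (suc ℓ) ℓ<n =
  let (L , L-distinct , L-length) = distinctOfLength ℓ (<⇒≤ ℓ<n)
      (i , i∉L) = fresh L (subst (_< _) (sym L-length) ℓ<n)
  in i ∷ L , Distinct-∷ {L = L} L-distinct i∉L , cong suc L-length

module Field {q : ℕ} (F : FiniteField q) where
  open FiniteField F

  fieldRing : CommutativeRing 0ℓ 0ℓ
  fieldRing = record
    { Carrier = Fin q ; _≈_ = _≡_ ; _+_ = _+F_ ; _*_ = _*F_ ; -_ = -F_ ; 0# = 0F ; 1# = 1F
    ; isCommutativeRing = isCommutativeRing
    }

  module R = CommutativeRing fieldRing
  open GroupProperties R.+-group public
    using (identityˡ-unique; //-rightDividesˡ; //-rightDividesʳ; \\-leftDividesˡ; \\-leftDividesʳ)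
  open CommutativeSemigroupProperties R.+-commutativeSemigroup public
    using (interchange)

  2≤q : 2 ≤ q
  2≤q = distinct⇒2≤ 0≢1

  instance
    q≢0 : NonZero q
    q≢0 = >-nonZero (≤-trans (s≤s z≤n) 2≤q)

  *-cancel-≡0 : ∀ {c x} → ¬ c ≡ 0F → c *F x ≡ 0F → x ≡ 0F
  *-cancel-≡0 {c} {x} c≢0 cx≡0 with inverse c c≢0
  ... | y , cy≡1 = begin
    x              ≡⟨ R.*-identityˡ x ⟨
    1F *F x        ≡⟨ cong (_*F x) (trans (R.*-comm y c) cy≡1) ⟨
    (y *F c) *F x  ≡⟨ R.*-assoc y c x ⟩
    y *F (c *F x)  ≡⟨ cong (y *F_) cx≡0 ⟩
    y *F 0F        ≡⟨ R.zeroʳ y ⟩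
    0F             ∎
    where open ≡-Reasoning

  *-inverseˡ : ∀ {c y} → c *F y ≡ 1F → ∀ x → c *F (y *F x) ≡ x
  *-inverseˡ {c} {y} cy≡1 x =
    trans (sym (R.*-assoc c y x)) (trans (cong (_*F x) cy≡1) (R.*-identityˡ x))

  *-inverseʳ : ∀ {c y} → c *F y ≡ 1F → ∀ x → y *F (c *F x) ≡ x
  *-inverseʳ {c} {y} cy≡1 = *-inverseˡ (trans (R.*-comm y c) cy≡1)

  inverse≢0 : ∀ {c y} → c *F y ≡ 1F → ¬ y ≡ 0F
  inverse≢0 {c} cy≡1 y≡0 = 0≢1 (trans (sym (R.zeroʳ c)) (trans (cong (c *F_) (sym y≡0)) cy≡1))

  𝟙-shift : ∀ x c → 𝟙 (c ≟ x +F c) ≡ 𝟙 (x ≟ 0F)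
  𝟙-shift x c = 𝟙-cong (c ≟ x +F c) (x ≟ 0F)
    (λ c≡x+c → identityˡ-unique x c (sym c≡x+c))
    (λ x≡0 → sym (trans (cong (_+F c) x≡0) (R.+-identityˡ c)))

  ∑-𝟙-affine≡1 : ∀ α β → ¬ α ≡ 0F → ∑[ c < q ] 𝟙 (β +F (c *F α) ≟ 0F) ≡ 1
  ∑-𝟙-affine≡1 α β α≢0 with inverse α α≢0
  ... | y , αy≡1 = begin
    ∑[ c < q ] 𝟙 (β +F (c *F α) ≟ 0F)
      ≡⟨ sum-reindex (λ μ → 𝟙 (β +F μ ≟ 0F)) (_*F α) (_*F y) (cancel αy≡1) (cancel yα≡1) ⟩
    ∑[ μ < q ] 𝟙 (β +F μ ≟ 0F)
      ≡⟨ sum-reindex (λ ν → 𝟙 (ν ≟ 0F)) (β +F_) ((-F β) +F_) (\\-leftDividesˡ β) (\\-leftDividesʳ β) ⟩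
    ∑[ ν < q ] 𝟙 (ν ≟ 0F)
      ≡⟨ sum-𝟙-≟ 0F ⟩
    1 ∎
    where
    open ≡-Reasoning
    yα≡1 : y *F α ≡ 1F
    yα≡1 = trans (R.*-comm y α) αy≡1
    cancel : ∀ {c d} → c *F d ≡ 1F → ∀ x → (x *F d) *F c ≡ x
    cancel {c} {d} cd≡1 x = trans (R.*-assoc x d c) (trans (cong (x *F_) (trans (R.*-comm d c) cd≡1)) (R.*-identityʳ x))

  pointOnPencil : ∀ α β → 𝟙 (α ≟ 0F) + ∑[ c < q ] 𝟙 (β +F (c *F α) ≟ 0F)
                        ≡ 1 + q * (𝟙 (α ≟ 0F) * 𝟙 (β ≟ 0F))
  pointOnPencil α β with α ≟ 0F
  ... | yes refl = cong suc (begin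
    ∑[ c < q ] 𝟙 (β +F (c *F 0F) ≟ 0F)
      ≡⟨ sum-cong-≗ {q} (λ c → cong (λ z → 𝟙 (z ≟ 0F)) (trans (cong (β +F_) (R.zeroʳ c)) (R.+-identityʳ β))) ⟩
    ∑[ c < q ] 𝟙 (β ≟ 0F)
      ≡⟨ sum-const q _ ⟩
    q * 𝟙 (β ≟ 0F)
      ≡⟨ cong (q *_) (+-identityʳ _) ⟨
    q * (1 * 𝟙 (β ≟ 0F)) ∎)
    where open ≡-Reasoning
  ... | no α≢0 = trans (∑-𝟙-affine≡1 α β α≢0) (cong suc (sym (*-zeroʳ q)))

module Vectors {q : ℕ} (F : FiniteField q) where
  open FiniteField F
  open Field F

  V : ℕ → Set
  V = Vector (Fin q)

  infixl 6 _+ᵥ_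
  infixl 7 _*ᵥ_

  _+ᵥ_ : V k → V k → V k
  (u +ᵥ w) i = u i +F w i

  _*ᵥ_ : Fin q → V k → V k
  (c *ᵥ u) i = c *F u i

  _∉span_ : V k → V k → Set
  v ∉span u = ∀ c → NonZeroVec F (v +ᵥ c *ᵥ u)

  Independent : V k → V k → Set
  Independent u v = NonZeroVec F u × v ∉span u

  Extensional : (V k → ℕ) → Set
  Extensional h = ∀ {u w} → u ≗ w → h u ≡ h w

  dot-congˡ : {u w : V k} → u ≗ w → ∀ x → dot F u x ≡ dot F w x
  dot-congˡ {zero}  u≗w x = refl
  dot-congˡ {suc k} u≗w x = cong₂ _+F_ (cong (_*F x zero) (u≗w zero)) (dot-congˡ (u≗w ∘ suc) (tail x))

  dot-+ˡ : (u w x : V k) → dot F (u +ᵥ w) x ≡ dot F u x +F dot F w x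
  dot-+ˡ {zero}  u w x = sym (R.+-identityʳ 0F)
  dot-+ˡ {suc k} u w x = trans
    (cong₂ _+F_ (R.distribʳ (x zero) (u zero) (w zero)) (dot-+ˡ (tail u) (tail w) (tail x)))
    (interchange _ _ _ _)

  dot-*ˡ : (c : Fin q) (u x : V k) → dot F (c *ᵥ u) x ≡ c *F dot F u x
  dot-*ˡ {zero}  c u x = sym (R.zeroʳ c)
  dot-*ˡ {suc k} c u x = trans
    (cong₂ _+F_ (R.*-assoc c (u zero) (x zero)) (dot-*ˡ c (tail u) (tail x)))
    (sym (R.distribˡ c _ _))

  0ᵥ : V k
  0ᵥ _ = 0F

  dot-zeroˡ : {u : V k} → (∀ i → u i ≡ 0F) → ∀ x → dot F u x ≡ 0F
  dot-zeroˡ {u = u} u≡0 x = begin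
    dot F u x          ≡⟨ dot-congˡ (λ i → trans (u≡0 i) (sym (R.zeroˡ (u i)))) x ⟩
    dot F (0F *ᵥ u) x  ≡⟨ dot-*ˡ 0F u x ⟩
    0F *F dot F u x    ≡⟨ R.zeroˡ _ ⟩
    0F                 ∎
    where open ≡-Reasoning

  ∑V : ∀ k → (V k → ℕ) → ℕ
  ∑V zero    h = h (λ ())
  ∑V (suc k) h = ∑[ a < q ] ∑V k (λ v → h (a ∷ᵥ v))

  ∑V-cong : {h h′ : V k → ℕ} → (∀ u → h u ≡ h′ u) → ∑V k h ≡ ∑V k h′
  ∑V-cong {zero}  h≗h′ = h≗h′ _
  ∑V-cong {suc k} h≗h′ = sum-cong-≗ {q} (λ a → ∑V-cong (h≗h′ ∘ (a ∷ᵥ_)))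

  ∑V-mono-≤ : {h h′ : V k → ℕ} → (∀ u → h u ≤ h′ u) → ∑V k h ≤ ∑V k h′
  ∑V-mono-≤ {zero}  h≤h′ = h≤h′ _
  ∑V-mono-≤ {suc k} h≤h′ = sum-mono-≤ (λ a → ∑V-mono-≤ (h≤h′ ∘ (a ∷ᵥ_)))

  ∑V-distrib-+ : (h h′ : V k → ℕ) → ∑V k (λ u → h u + h′ u) ≡ ∑V k h + ∑V k h′
  ∑V-distrib-+ {zero}  h h′ = refl
  ∑V-distrib-+ {suc k} h h′ = trans
    (sum-cong-≗ {q} (λ a → ∑V-distrib-+ (h ∘ (a ∷ᵥ_)) (h′ ∘ (a ∷ᵥ_))))
    (∑-distrib-+ (λ a → ∑V k (h ∘ (a ∷ᵥ_))) (λ a → ∑V k (h′ ∘ (a ∷ᵥ_))))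

  ∑V-*ˡ : ∀ c (h : V k → ℕ) → ∑V k (λ u → c * h u) ≡ c * ∑V k h
  ∑V-*ˡ {zero}  c h = refl
  ∑V-*ˡ {suc k} c h = trans
    (sum-cong-≗ {q} (λ a → ∑V-*ˡ c (h ∘ (a ∷ᵥ_))))
    (sum-*ˡ c (λ a → ∑V k (h ∘ (a ∷ᵥ_))))

  ∑V-const : ∀ k c → ∑V k (λ _ → c) ≡ q ^ k * c
  ∑V-const zero    c = sym (+-identityʳ c)
  ∑V-const (suc k) c = begin
    ∑[ a < q ] ∑V k (λ _ → c) ≡⟨ sum-cong-≗ {q} (λ _ → ∑V-const k c) ⟩
    ∑[ a < q ] (q ^ k * c)    ≡⟨ sum-const q _ ⟩
    q * (q ^ k * c)           ≡⟨ *-assoc q (q ^ k) c ⟨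
    q ^ suc k * c             ∎
    where open ≡-Reasoning

  ∑V-comm : (f : Fin m → V k → ℕ) → ∑V k (λ u → ∑[ i < m ] f i u) ≡ ∑[ i < m ] ∑V k (f i)
  ∑V-comm {m} {zero}  f = refl
  ∑V-comm {m} {suc k} f = trans (sum-cong-≗ {q} (λ a → ∑V-comm (λ i v → f i (a ∷ᵥ v)))) (∑-comm {q} {m} _)

  ∑V>0⇒∃ : (h : V k → ℕ) → 0 < ∑V k h → ∃ λ u → 0 < h u
  ∑V>0⇒∃ {zero}  h h>0 = (λ ()) , h>0
  ∑V>0⇒∃ {suc k} h ∑h>0 =
    let (a , ∑ha>0) = sum>0⇒∃ _ ∑h>0
        (v , hav>0) = ∑V>0⇒∃ (λ v → h (a ∷ᵥ v)) ∑ha>0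
    in a ∷ᵥ v , hav>0

  ∷ᵥ-cong : ∀ {a b} {v w : V k} → a ≡ b → v ≗ w → (a ∷ᵥ v) ≗ (b ∷ᵥ w)
  ∷ᵥ-cong a≡b v≗w zero    = a≡b
  ∷ᵥ-cong a≡b v≗w (suc i) = v≗w i

  ∑V-reindex : (h : V k → ℕ) → Extensional h → (φ ψ : Fin k → Fin q → Fin q) →
               (∀ i x → φ i (ψ i x) ≡ x) → (∀ i x → ψ i (φ i x) ≡ x) →
               ∑V k (λ u → h (λ i → φ i (u i))) ≡ ∑V k h
  ∑V-reindex {zero}  h h-ext φ ψ φψ ψφ = h-ext (λ ())
  ∑V-reindex {suc k} h h-ext φ ψ φψ ψφ = begin
    ∑[ a < q ] ∑V k (λ v → h (λ i → φ i ((a ∷ᵥ v) i)))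
      ≡⟨ sum-cong-≗ {q} (λ a → ∑V-cong {k} (λ v → h-ext λ { zero → refl ; (suc i) → refl })) ⟩
    ∑[ a < q ] ∑V k (λ v → h (φ zero a ∷ᵥ (λ i → φ (suc i) (v i))))
      ≡⟨ sum-cong-≗ {q} (λ a → ∑V-reindex (λ w → h (φ zero a ∷ᵥ w)) (h-ext ∘ ∷ᵥ-cong refl)
                             (φ ∘ suc) (ψ ∘ suc) (φψ ∘ suc) (ψφ ∘ suc)) ⟩
    ∑[ a < q ] ∑V k (λ w → h (φ zero a ∷ᵥ w))
      ≡⟨ sum-reindex (λ b → ∑V k (λ w → h (b ∷ᵥ w))) (φ zero) (ψ zero) (φψ zero) (ψφ zero) ⟩
    ∑V (suc k) h ∎
    where open ≡-Reasoning

  ∑V-translate : (h : V k → ℕ) → Extensional h → (w : V k) → ∑V k (λ u → h (u +ᵥ w)) ≡ ∑V k h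
  ∑V-translate h h-ext w = ∑V-reindex h h-ext (λ i x → x +F w i) (λ i x → x +F (-F w i))
    (λ i x → //-rightDividesˡ (w i) x) (λ i x → //-rightDividesʳ (w i) x)

module Projective {q : ℕ} (F : FiniteField q) where
  open FiniteField F
  open Field F
  open Vectors F

  isZero isNonZero : V k → ℕ
  isZero    {zero}  u = 1
  isZero    {suc k} u = if isYes (u zero ≟ 0F) then isZero (tail u) else 0
  isNonZero {zero}  u = 0
  isNonZero {suc k} u = if isYes (u zero ≟ 0F) then isNonZero (tail u) else 1

  -- One nonzero vector on each line through the origin, hence one normal per hyperplane.
  isNormalised : V k → ℕ
  isNormalised {zero}  u = 0
  isNormalised {suc k} u = if isYes (u zero ≟ 0F) then isNormalised (tail u) else 𝟙 (u zero ≟ 1F)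

  isZero+isNonZero≡1 : (u : V k) → isZero u + isNonZero u ≡ 1
  isZero+isNonZero≡1 {zero}  u = refl
  isZero+isNonZero≡1 {suc k} u with u zero ≟ 0F
  ... | yes _ = isZero+isNonZero≡1 (tail u)
  ... | no _  = refl

  isZero≤1 : (u : V k) → isZero u ≤ 1
  isZero≤1 u = subst (isZero u ≤_) (isZero+isNonZero≡1 u) (m≤m+n _ _)

  isZero-ext : Extensional (isZero {k})
  isZero-ext {zero}  u≗w = refl
  isZero-ext {suc k} {u} {w} u≗w rewrite u≗w zero =
    cong (λ z → if isYes (w zero ≟ 0F) then z else 0) (isZero-ext (u≗w ∘ suc))

  isZero≡1⇒≡0 : (u : V k) → isZero u ≡ 1 → ∀ i → u i ≡ 0F
  isZero≡1⇒≡0 {suc k} u eq i with u zero ≟ 0F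
  isZero≡1⇒≡0 {suc k} u eq zero    | yes u₀≡0 = u₀≡0
  isZero≡1⇒≡0 {suc k} u eq (suc i) | yes _    = isZero≡1⇒≡0 (tail u) eq i

  ≡0⇒isZero≡1 : (u : V k) → (∀ i → u i ≡ 0F) → isZero u ≡ 1
  ≡0⇒isZero≡1 {zero}  u u≡0 = refl
  ≡0⇒isZero≡1 {suc k} u u≡0 with u zero ≟ 0F
  ... | yes _    = ≡0⇒isZero≡1 (tail u) (u≡0 ∘ suc)
  ... | no u₀≢0 = ⊥-elim (u₀≢0 (u≡0 zero))

  isZero≡0⇒NonZeroVec : (u : V k) → isZero u ≡ 0 → NonZeroVec F u
  isZero≡0⇒NonZeroVec u eq u≡0 = 0≢1+n (trans (sym eq) (≡0⇒isZero≡1 u u≡0))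

  isNonZero>0⇒isZero≡0 : (u : V k) → 0 < isNonZero u → isZero u ≡ 0
  isNonZero>0⇒isZero≡0 u nz>0 with isZero u | isZero+isNonZero≡1 u
  ... | zero  | _  = refl
  ... | suc x | eq = ⊥-elim (n>0⇒n≢0 nz>0 (m+n≡0⇒n≡0 x (suc-injective eq)))

  ∑V-split-isZero : (h : V k → ℕ) → ∑V k h ≡ ∑V k (λ u → isZero u * h u) + ∑V k (λ u → isNonZero u * h u)
  ∑V-split-isZero {k} h = trans (∑V-cong {k} split) (∑V-distrib-+ (λ u → isZero u * h u) (λ u → isNonZero u * h u))
    where
    split : ∀ u → h u ≡ isZero u * h u + isNonZero u * h u
    split u = sym (trans (sym (*-distribʳ-+ (h u) (isZero u) (isNonZero u)))
                         (trans (cong (_* h u) (isZero+isNonZero≡1 u)) (*-identityˡ (h u))))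

  ∑V-isZero : ∀ k → ∑V k isZero ≡ 1
  ∑V-isZero zero    = refl
  ∑V-isZero (suc k) = begin
    ∑[ a < q ] ∑V k (λ v → if isYes (a ≟ 0F) then isZero v else 0)
      ≡⟨ sum-cong-≗ {q} row ⟩
    ∑[ a < q ] (if isYes (a ≟ 0F) then 1 else 0)
      ≡⟨ sum-𝟙-≟ 0F ⟩
    1 ∎
    where
    open ≡-Reasoning
    row : ∀ a → ∑V k (λ v → if isYes (a ≟ 0F) then isZero v else 0) ≡ (if isYes (a ≟ 0F) then 1 else 0)
    row a with a ≟ 0F
    ... | yes _ = ∑V-isZero k
    ... | no _  = trans (∑V-const k 0) (*-zeroʳ (q ^ k))

  ScaleInvariant : (V k → ℕ) → Set
  ScaleInvariant h = ∀ c → ¬ c ≡ 0F → ∀ u → h (c *ᵥ u) ≡ h u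

  ∑V-rows-agree : (h : V (suc k) → ℕ) → Extensional h → ScaleInvariant h →
                  ∀ a → ¬ a ≡ 0F → ∑V k (λ v → h (a ∷ᵥ v)) ≡ ∑V k (λ v → h (1F ∷ᵥ v))
  ∑V-rows-agree {k} h h-ext h-inv a a≢0 with inverse a a≢0
  ... | y , ay≡1 = begin
    ∑V k (λ v → h (a ∷ᵥ v))
      ≡⟨ ∑V-cong {k} (λ v → h-inv y (inverse≢0 ay≡1) (a ∷ᵥ v)) ⟨
    ∑V k (λ v → h (y *ᵥ (a ∷ᵥ v)))
      ≡⟨ ∑V-cong {k} (λ v → h-ext λ { zero → trans (R.*-comm y a) ay≡1 ; (suc i) → refl }) ⟩
    ∑V k (λ v → h (1F ∷ᵥ (y *ᵥ v)))
      ≡⟨ ∑V-reindex (λ w → h (1F ∷ᵥ w)) (h-ext ∘ ∷ᵥ-cong refl) (λ _ → y *F_) (λ _ → a *F_)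
           (λ _ → *-inverseʳ ay≡1) (λ _ → *-inverseˡ ay≡1) ⟩
    ∑V k (λ v → h (1F ∷ᵥ v)) ∎
    where open ≡-Reasoning

  ∑V-isNonZero-rows : (h : V (suc k) → ℕ) → Extensional h → ScaleInvariant h →
                      ∑V (suc k) (λ u → isNonZero u * h u)
                      ≡ ∑V k (λ v → isNonZero v * h (0F ∷ᵥ v)) + (q ∸ 1) * ∑V k (λ v → h (1F ∷ᵥ v))
  ∑V-isNonZero-rows {k} h h-ext h-inv = begin
    ∑[ a < q ] ∑V k (λ v → (if isYes (a ≟ 0F) then isNonZero v else 1) * h (a ∷ᵥ v))
      ≡⟨ sum-cong-≗ {q} row ⟩
    ∑[ a < q ] (if isYes (a ≟ 0F) then X else Y)
      ≡⟨ sum-if-≟ 0F X Y ⟩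
    X + (q ∸ 1) * Y ∎
    where
    open ≡-Reasoning
    X Y : ℕ
    X = ∑V k (λ v → isNonZero v * h (0F ∷ᵥ v))
    Y = ∑V k (λ v → h (1F ∷ᵥ v))
    row : ∀ a → ∑V k (λ v → (if isYes (a ≟ 0F) then isNonZero v else 1) * h (a ∷ᵥ v))
              ≡ (if isYes (a ≟ 0F) then X else Y)
    row a with a ≟ 0F
    ... | yes refl = refl
    ... | no a≢0   = trans (∑V-cong {k} (λ v → +-identityʳ _)) (∑V-rows-agree h h-ext h-inv a a≢0)

  ∑V-isNormalised-rows : (h : V (suc k) → ℕ) → Extensional h → ScaleInvariant h →
                         ∑V (suc k) (λ u → isNormalised u * h u)
                         ≡ ∑V k (λ v → isNormalised v * h (0F ∷ᵥ v)) + ∑V k (λ v → h (1F ∷ᵥ v))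
  ∑V-isNormalised-rows {k} h h-ext h-inv = begin
    ∑[ a < q ] ∑V k (λ v → (if isYes (a ≟ 0F) then isNormalised v else 𝟙 (a ≟ 1F)) * h (a ∷ᵥ v))
      ≡⟨ sum-cong-≗ {q} row ⟩
    ∑[ a < q ] ((if isYes (a ≟ 0F) then X else 0) + 𝟙 (a ≟ 1F) * Y)
      ≡⟨ ∑-distrib-+ (λ a → if isYes (a ≟ 0F) then X else 0) (λ a → 𝟙 (a ≟ 1F) * Y) ⟩
    ∑[ a < q ] (if isYes (a ≟ 0F) then X else 0) + ∑[ a < q ] (𝟙 (a ≟ 1F) * Y)
      ≡⟨ cong₂ _+_ (sum-if-≟ 0F X 0) (sym (*-distribʳ-sum Y (λ a → 𝟙 (a ≟ 1F)))) ⟩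
    X + (q ∸ 1) * 0 + ∑[ a < q ] 𝟙 (a ≟ 1F) * Y
      ≡⟨ cong₂ (λ z w → X + z + w * Y) (*-zeroʳ (q ∸ 1)) (sum-𝟙-≟ 1F) ⟩
    X + 0 + 1 * Y
      ≡⟨ cong₂ _+_ (+-identityʳ X) (*-identityˡ Y) ⟩
    X + Y ∎
    where
    open ≡-Reasoning
    X Y : ℕ
    X = ∑V k (λ v → isNormalised v * h (0F ∷ᵥ v))
    Y = ∑V k (λ v → h (1F ∷ᵥ v))
    row : ∀ a → ∑V k (λ v → (if isYes (a ≟ 0F) then isNormalised v else 𝟙 (a ≟ 1F)) * h (a ∷ᵥ v))
              ≡ (if isYes (a ≟ 0F) then X else 0) + 𝟙 (a ≟ 1F) * Y
    row a with a ≟ 0F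
    ... | yes refl = sym (trans (cong (λ z → X + z * Y) (𝟙-no (0F ≟ 1F) 0≢1)) (+-identityʳ X))
    ... | no a≢0   = trans (∑V-*ˡ {k} (𝟙 (a ≟ 1F)) _) (cong (𝟙 (a ≟ 1F) *_) (∑V-rows-agree h h-ext h-inv a a≢0))

  ∑V-isNonZero≡[q∸1]*∑V-isNormalised :
    ∀ k (h : V k → ℕ) → Extensional h → ScaleInvariant h →
    ∑V k (λ u → isNonZero u * h u) ≡ (q ∸ 1) * ∑V k (λ u → isNormalised u * h u)
  ∑V-isNonZero≡[q∸1]*∑V-isNormalised zero    h h-ext h-inv = sym (*-zeroʳ (q ∸ 1))
  ∑V-isNonZero≡[q∸1]*∑V-isNormalised (suc k) h h-ext h-inv = begin
    ∑V (suc k) (λ u → isNonZero u * h u)      ≡⟨ ∑V-isNonZero-rows h h-ext h-inv ⟩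
    X + (q ∸ 1) * Y                           ≡⟨ cong (_+ (q ∸ 1) * Y) firstCoordinateZero ⟩
    (q ∸ 1) * X′ + (q ∸ 1) * Y                ≡⟨ *-distribˡ-+ (q ∸ 1) X′ Y ⟨
    (q ∸ 1) * (X′ + Y)                        ≡⟨ cong ((q ∸ 1) *_) (∑V-isNormalised-rows h h-ext h-inv) ⟨
    (q ∸ 1) * ∑V (suc k) (λ u → isNormalised u * h u) ∎
    where
    open ≡-Reasoning
    h₀ : V k → ℕ
    h₀ v = h (0F ∷ᵥ v)
    X X′ Y : ℕ
    X  = ∑V k (λ v → isNonZero v * h₀ v)
    X′ = ∑V k (λ v → isNormalised v * h₀ v)
    Y  = ∑V k (λ v → h (1F ∷ᵥ v))
    firstCoordinateZero : X ≡ (q ∸ 1) * X′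
    firstCoordinateZero = ∑V-isNonZero≡[q∸1]*∑V-isNormalised k h₀ (h-ext ∘ ∷ᵥ-cong refl)
      (λ c c≢0 v → trans (h-ext λ { zero → sym (R.zeroʳ c) ; (suc i) → refl }) (h-inv c c≢0 (0F ∷ᵥ v)))

hypCount≡∑ : {q : ℕ} (F : FiniteField q) (G : Fin n → Fin k → Fin q) (u : Fin k → Fin q) →
             hypCount F G u ≡ ∑[ i < n ] 𝟙 (dot F u (G i) ≟ FiniteField.0F F)
hypCount≡∑ {zero}  F G u = refl
hypCount≡∑ {suc n} F G u with dot F u (G zero) ≟ FiniteField.0F F
... | yes _ = cong suc (hypCount≡∑ F (G ∘ suc) u)
... | no _  = hypCount≡∑ F (G ∘ suc) u

module Hyperplanes {q : ℕ} (F : FiniteField q) {n k : ℕ} (G : Fin n → Fin k → Fin q) where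
  open FiniteField F
  open Field F
  open Vectors F
  open Projective F

  onHyp : Fin n → V k → ℕ
  onHyp i u = 𝟙 (dot F u (G i) ≟ 0F)

  onHyp-ext : ∀ i → Extensional (onHyp i)
  onHyp-ext i u≗w = cong (λ z → 𝟙 (z ≟ 0F)) (dot-congˡ u≗w (G i))

  onHyp-scale : ∀ i → ScaleInvariant (onHyp i)
  onHyp-scale i c c≢0 u = trans (cong (λ z → 𝟙 (z ≟ 0F)) (dot-*ˡ c u (G i)))
    (𝟙-cong (c *F dot F u (G i) ≟ 0F) (dot F u (G i) ≟ 0F)
      (*-cancel-≡0 c≢0) (λ eq → trans (cong (c *F_) eq) (R.zeroʳ c)))

  onHyp-translate : ∀ i u w → onHyp i w ≡ 1 → onHyp i (u +ᵥ w) ≡ onHyp i u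
  onHyp-translate i u w w∈H = cong (λ z → 𝟙 (z ≟ 0F)) (begin
    dot F (u +ᵥ w) (G i)            ≡⟨ dot-+ˡ u w (G i) ⟩
    dot F u (G i) +F dot F w (G i)  ≡⟨ cong (dot F u (G i) +F_) (𝟙>0⇒ (dot F w (G i) ≟ 0F) (≤-reflexive (sym w∈H))) ⟩
    dot F u (G i) +F 0F             ≡⟨ R.+-identityʳ _ ⟩
    dot F u (G i)                   ∎)
    where open ≡-Reasoning

  hypCount-ext : Extensional (hypCount F G)
  hypCount-ext {u} {w} u≗w =
    trans (hypCount≡∑ F G u) (trans (sum-cong-≗ {n} (λ i → onHyp-ext i u≗w)) (sym (hypCount≡∑ F G w)))

  hypCount-scale : ScaleInvariant (hypCount F G)
  hypCount-scale c c≢0 u =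
    trans (hypCount≡∑ F G _) (trans (sum-cong-≗ {n} (λ i → onHyp-scale i c c≢0 u)) (sym (hypCount≡∑ F G u)))

  common : V k → V k → ℕ
  common u v = ∑[ i < n ] (onHyp i u * onHyp i v)

  pencilCount : ∀ u v → hypCount F G u + ∑[ c < q ] hypCount F G (v +ᵥ c *ᵥ u) ≡ n + q * common u v
  pencilCount u v = begin
    hypCount F G u + ∑[ c < q ] hypCount F G (v +ᵥ c *ᵥ u)
      ≡⟨ cong₂ _+_ (hypCount≡∑ F G u)
                   (sum-cong-≗ {q} (λ c → trans (hypCount≡∑ F G _) (sum-cong-≗ {n} (onPencil c)))) ⟩
    ∑[ i < n ] onHyp i u + ∑[ c < q ] ∑[ i < n ] 𝟙 (β i +F (c *F α i) ≟ 0F)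
      ≡⟨ cong (∑[ i < n ] onHyp i u +_) (∑-comm {q} {n} _) ⟩
    ∑[ i < n ] onHyp i u + ∑[ i < n ] ∑[ c < q ] 𝟙 (β i +F (c *F α i) ≟ 0F)
      ≡⟨ ∑-distrib-+ (λ i → onHyp i u) (λ i → ∑[ c < q ] 𝟙 (β i +F (c *F α i) ≟ 0F)) ⟨
    ∑[ i < n ] (onHyp i u + ∑[ c < q ] 𝟙 (β i +F (c *F α i) ≟ 0F))
      ≡⟨ sum-cong-≗ {n} (λ i → pointOnPencil (α i) (β i)) ⟩
    ∑[ i < n ] (1 + q * (onHyp i u * onHyp i v))
      ≡⟨ ∑-distrib-+ (λ _ → 1) (λ i → q * (onHyp i u * onHyp i v)) ⟩
    ∑[ i < n ] 1 + ∑[ i < n ] (q * (onHyp i u * onHyp i v))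
      ≡⟨ cong₂ _+_ (trans (sum-const n 1) (*-identityʳ n)) (sum-*ˡ q (λ i → onHyp i u * onHyp i v)) ⟩
    n + q * common u v ∎
    where
    open ≡-Reasoning
    α β : Fin n → Fin q
    α i = dot F u (G i)
    β i = dot F v (G i)
    onPencil : ∀ c i → onHyp i (v +ᵥ c *ᵥ u) ≡ 𝟙 (β i +F (c *F α i) ≟ 0F)
    onPencil c i = cong (λ z → 𝟙 (z ≟ 0F))
      (trans (dot-+ˡ v (c *ᵥ u) (G i)) (cong (β i +F_) (dot-*ˡ c u (G i))))

  through : List (Fin n) → V k → ℕ
  through []      u = 1
  through (i ∷ L) u = onHyp i u * through L u

  through≤1 : ∀ L u → through L u ≤ 1
  through≤1 []      u = ≤-refl
  through≤1 (i ∷ L) u = *-mono-≤ (𝟙≤1 (dot F u (G i) ≟ 0F)) (through≤1 L u)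

  through≡1⇒ : ∀ i L u → through (i ∷ L) u ≡ 1 → onHyp i u ≡ 1 × through L u ≡ 1
  through≡1⇒ i L u eq = m*n≡1⇒m≡1 (onHyp i u) _ eq , m*n≡1⇒n≡1 (onHyp i u) _ eq

  through-ext : ∀ L → Extensional (through L)
  through-ext []      u≗w = refl
  through-ext (i ∷ L) u≗w = cong₂ _*_ (onHyp-ext i u≗w) (through-ext L u≗w)

  through-scale : ∀ L → ScaleInvariant (through L)
  through-scale []      c c≢0 u = refl
  through-scale (i ∷ L) c c≢0 u = cong₂ _*_ (onHyp-scale i c c≢0 u) (through-scale L c c≢0 u)

  through-translate : ∀ L u w → through L w ≡ 1 → through L (u +ᵥ w) ≡ through L u
  through-translate []      u w _   = refl
  through-translate (i ∷ L) u w w∈A =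
    let (w∈H , w∈A′) = through≡1⇒ i L w w∈A
    in cong₂ _*_ (onHyp-translate i u w w∈H) (through-translate L u w w∈A′)

  through-zero : ∀ L u → (∀ i → u i ≡ 0F) → through L u ≡ 1
  through-zero []      u u≡0 = refl
  through-zero (i ∷ L) u u≡0 =
    cong₂ _*_ (𝟙-yes (dot F u (G i) ≟ 0F) (dot-zeroˡ u≡0 (G i))) (through-zero L u u≡0)

  through⇒onHyp : ∀ L u j → through L u ≡ 1 → 0 < occurrences j L → onHyp j u ≡ 1
  through⇒onHyp (i ∷ L) u j u∈A j∈L with j ≟ i | through≡1⇒ i L u u∈A
  ... | yes refl | u∈H , _   = u∈H
  ... | no _     | _ , u∈A′ = through⇒onHyp L u j u∈A′ j∈L

  length≤common : ∀ L u v → Distinct L → through L u ≡ 1 → through L v ≡ 1 → length L ≤ common u v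
  length≤common L u v L-distinct u∈A v∈A =
    subst (_≤ common u v) (∑-occurrences L) (sum-mono-≤ occurrence≤)
    where
    occurrence≤ : ∀ j → occurrences j L ≤ onHyp j u * onHyp j v
    occurrence≤ j with n≤1⇒n≡0∨n≡1 (L-distinct j)
    ... | inj₁ j∉L = subst (_≤ _) (sym j∉L) z≤n
    ... | inj₂ j∈L = ≤-reflexive (trans j∈L (sym (cong₂ _*_
          (through⇒onHyp L u j u∈A j>0) (through⇒onHyp L v j v∈A j>0))))
      where
      j>0 : 0 < occurrences j L
      j>0 = subst (0 <_) (sym j∈L) (s≤s z≤n)

  ∑V-isZero*through : ∀ L → ∑V k (λ u → isZero u * through L u) ≡ 1
  ∑V-isZero*through L = trans (∑V-cong {k} only-0ᵥ) (∑V-isZero k)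
    where
    only-0ᵥ : ∀ u → isZero u * through L u ≡ isZero u
    only-0ᵥ u with n≤1⇒n≡0∨n≡1 (isZero≤1 u)
    ... | inj₁ u≢0 rewrite u≢0 = refl
    ... | inj₂ u≡0 rewrite u≡0 = trans (+-identityʳ _) (through-zero L u (isZero≡1⇒≡0 u u≡0))

  hypCount-split : ∀ L u → Distinct L → through L u ≡ 1 →
                   hypCount F G u ≡ length L + ∑[ j < n ] ((1 ∸ occurrences j L) * onHyp j u)
  hypCount-split L u L-distinct u∈A = begin
    hypCount F G u
      ≡⟨ hypCount≡∑ F G u ⟩
    ∑[ j < n ] onHyp j u
      ≡⟨ sum-cong-≗ {n} split ⟩
    ∑[ j < n ] (occurrences j L + (1 ∸ occurrences j L) * onHyp j u)
      ≡⟨ ∑-distrib-+ (λ j → occurrences j L) (λ j → (1 ∸ occurrences j L) * onHyp j u) ⟩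
    ∑[ j < n ] occurrences j L + ∑[ j < n ] ((1 ∸ occurrences j L) * onHyp j u)
      ≡⟨ cong (_+ ∑[ j < n ] ((1 ∸ occurrences j L) * onHyp j u)) (∑-occurrences L) ⟩
    length L + ∑[ j < n ] ((1 ∸ occurrences j L) * onHyp j u) ∎
    where
    open ≡-Reasoning
    split : ∀ j → onHyp j u ≡ occurrences j L + (1 ∸ occurrences j L) * onHyp j u
    split j with n≤1⇒n≡0∨n≡1 (L-distinct j)
    ... | inj₁ j∉L rewrite j∉L = sym (+-identityʳ (onHyp j u))
    ... | inj₂ j∈L rewrite j∈L = through⇒onHyp L u j u∈A (subst (0 <_) (sym j∈L) (s≤s z≤n))

  fibre : List (Fin n) → Fin n → Fin q → V k → ℕ
  fibre L i c u = through L u * 𝟙 (c ≟ dot F u (G i))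

  -- Translation by any vector w of a nonempty fibre maps the fibre over 0F onto it.
  ∑V-fibre≤∑V-through-∷ : ∀ L i c → ∑V k (fibre L i c) ≤ ∑V k (through (i ∷ L))
  ∑V-fibre≤∑V-through-∷ L i c with ∑V k (fibre L i c) in eq
  ... | zero  = z≤n
  ... | suc _ = ≤-reflexive (begin
    suc _                                  ≡⟨ eq ⟨
    ∑V k (fibre L i c)                     ≡⟨ ∑V-translate (fibre L i c) fibre-ext w ⟨
    ∑V k (λ u → fibre L i c (u +ᵥ w))      ≡⟨ ∑V-cong {k} shift ⟩
    ∑V k (through (i ∷ L))                 ∎)
    where
    open ≡-Reasoning
    φ : V k → Fin q
    φ u = dot F u (G i)
    w∈fibre : ∃ λ w → 0 < fibre L i c w
    w∈fibre = ∑V>0⇒∃ (fibre L i c) (subst (0 <_) (sym eq) (s≤s z≤n))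
    w : V k
    w = proj₁ w∈fibre
    w∈A : through L w ≡ 1
    w∈A = ≤1∧>0⇒≡1 (through≤1 L w) (proj₁ (*>0⇒ (through L w) _ (proj₂ w∈fibre)))
    c≡φw : c ≡ φ w
    c≡φw = 𝟙>0⇒ (c ≟ φ w) (proj₂ (*>0⇒ (through L w) _ (proj₂ w∈fibre)))
    fibre-ext : Extensional (fibre L i c)
    fibre-ext u≗v = cong₂ _*_ (through-ext L u≗v) (cong (λ z → 𝟙 (c ≟ z)) (dot-congˡ u≗v (G i)))
    shift : ∀ u → fibre L i c (u +ᵥ w) ≡ through (i ∷ L) u
    shift u = trans (*-comm (through L (u +ᵥ w)) _) (cong₂ _*_
      (trans (cong (λ z → 𝟙 (c ≟ z)) (trans (dot-+ˡ u w (G i)) (cong (φ u +F_) (sym c≡φw))))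
             (𝟙-shift (φ u) c))
      (through-translate L u w w∈A))

  ∑V-through≤q*∑V-through-∷ : ∀ L i → ∑V k (through L) ≤ q * ∑V k (through (i ∷ L))
  ∑V-through≤q*∑V-through-∷ L i = begin
    ∑V k (through L)
      ≡⟨ ∑V-cong {k} (λ u → trans (sym (*-identityʳ _)) (cong (through L u *_) (sym (sum-𝟙-≟ (φ u))))) ⟩
    ∑V k (λ u → through L u * ∑[ c < q ] 𝟙 (c ≟ φ u))
      ≡⟨ ∑V-cong {k} (λ u → sum-*ˡ (through L u) (λ c → 𝟙 (c ≟ φ u))) ⟨
    ∑V k (λ u → ∑[ c < q ] fibre L i c u)
      ≡⟨ ∑V-comm (fibre L i) ⟩
    ∑[ c < q ] ∑V k (fibre L i c)
      ≤⟨ sum-mono-≤ (∑V-fibre≤∑V-through-∷ L i) ⟩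
    ∑[ c < q ] ∑V k (through (i ∷ L))
      ≡⟨ sum-const q _ ⟩
    q * ∑V k (through (i ∷ L)) ∎
    where
    open ≤-Reasoning
    φ : V k → Fin q
    φ u = dot F u (G i)

  q^k≤∑V-through*q^length : ∀ L → q ^ k ≤ ∑V k (through L) * q ^ length L
  q^k≤∑V-through*q^length [] = ≤-reflexive (begin
    q ^ k          ≡⟨ *-identityʳ (q ^ k) ⟨
    q ^ k * 1      ≡⟨ ∑V-const k 1 ⟨
    ∑V k (λ _ → 1) ≡⟨ *-identityʳ _ ⟨
    ∑V k (λ _ → 1) * 1 ∎)
    where open ≡-Reasoning
  q^k≤∑V-through*q^length (i ∷ L) = begin
    q ^ k                                            ≤⟨ q^k≤∑V-through*q^length L ⟩
    ∑V k (through L) * q ^ length L                  ≤⟨ *-monoˡ-≤ (q ^ length L) (∑V-through≤q*∑V-through-∷ L i) ⟩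
    q * ∑V k (through (i ∷ L)) * q ^ length L        ≡⟨ cong (_* q ^ length L) (*-comm q _) ⟩
    ∑V k (through (i ∷ L)) * q * q ^ length L        ≡⟨ *-assoc (∑V k (through (i ∷ L))) q _ ⟩
    ∑V k (through (i ∷ L)) * q ^ length (i ∷ L)      ∎
    where open ≤-Reasoning

  -- The line through u has only the q points -c u, so among more than q vectors of the
  -- annihilator one lies off it.
  ∃-independent : ∀ L → q < ∑V k (through L) → ∀ u → ∃ λ v → through L v ≡ 1 × v ∉span u
  ∃-independent L q<A u = v , ≤1∧>0⇒≡1 (through≤1 L v) (proj₁ v-props) , v∉span
    where
    onLine : V k → ℕ
    onLine w = ∑[ c < q ] isZero (w +ᵥ c *ᵥ u)
    offLineInA : V k → ℕ
    offLineInA w = through L w * 𝟙 (onLine w ≟ℕ 0)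
    ∑V-onLine : ∑V k onLine ≡ q
    ∑V-onLine = begin
      ∑V k onLine
        ≡⟨ ∑V-comm (λ c w → isZero (w +ᵥ c *ᵥ u)) ⟩
      ∑[ c < q ] ∑V k (λ w → isZero (w +ᵥ c *ᵥ u))
        ≡⟨ sum-cong-≗ {q} (λ c → trans (∑V-translate isZero isZero-ext (c *ᵥ u)) (∑V-isZero k)) ⟩
      ∑[ c < q ] 1
        ≡⟨ trans (sum-const q 1) (*-identityʳ q) ⟩
      q ∎
      where open ≡-Reasoning
    through≤offLineInA+onLine : ∀ w → through L w ≤ offLineInA w + onLine w
    through≤offLineInA+onLine w with onLine w
    ... | zero  = ≤-reflexive (sym (trans (+-identityʳ _) (*-identityʳ _)))
    ... | suc x = ≤-trans (through≤1 L w) (≤-trans (s≤s z≤n) (m≤n+m (suc x) _))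
    ∑V-offLineInA>0 : 0 < ∑V k offLineInA
    ∑V-offLineInA>0 = +-cancelʳ-< q 0 (∑V k offLineInA) (begin-strict
      0 + q                                  <⟨ q<A ⟩
      ∑V k (through L)                       ≤⟨ ∑V-mono-≤ through≤offLineInA+onLine ⟩
      ∑V k (λ w → offLineInA w + onLine w)   ≡⟨ ∑V-distrib-+ offLineInA onLine ⟩
      ∑V k offLineInA + ∑V k onLine          ≡⟨ cong (∑V k offLineInA +_) ∑V-onLine ⟩
      ∑V k offLineInA + q                    ∎)
      where open ≤-Reasoning
    v : V k
    v = proj₁ (∑V>0⇒∃ offLineInA ∑V-offLineInA>0)
    v-props : 0 < through L v × 0 < 𝟙 (onLine v ≟ℕ 0)
    v-props = *>0⇒ (through L v) _ (proj₂ (∑V>0⇒∃ offLineInA ∑V-offLineInA>0))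
    v∉span : v ∉span u
    v∉span c = isZero≡0⇒NonZeroVec (v +ᵥ c *ᵥ u)
      (sum≡0⇒≡0 (λ c → isZero (v +ᵥ c *ᵥ u)) (𝟙>0⇒ (onLine v ≟ℕ 0) (proj₂ v-props)) c)

  ∃-nonzero : ∀ L → q < ∑V k (through L) → ∃ λ u → through L u ≡ 1 × NonZeroVec F u
  ∃-nonzero L q<A =
    let (u , u∈A , u-off-0) = ∃-independent L q<A 0ᵥ
    in u , u∈A , λ u≡0 → u-off-0 0F (λ i → trans (cong₂ _+F_ (u≡0 i) (R.zeroʳ 0F)) (R.+-identityʳ 0F))

module Extremal {q : ℕ} (F : FiniteField q) {n k : ℕ} (G : Fin n → Fin k → Fin q) (a t : ℕ)
  (bound : ∀ u → NonZeroVec F u → hypCount F G u ≤ a)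
  (balance : a + q * a ≡ n + q * t) where
  open FiniteField F
  open Field F
  open Vectors F
  open Projective F
  open Hyperplanes F G

  -- The q + 1 hyperplanes of the pencil spanned by u and v each carry at most a points.
  pencil≤ : ∀ u v → Independent u v → n + q * common u v ≤ hypCount F G u + q * a
  pencil≤ u v (u≢0 , pencil≢0) = begin
    n + q * common u v
      ≡⟨ pencilCount u v ⟨
    hypCount F G u + ∑[ c < q ] hypCount F G (v +ᵥ c *ᵥ u)
      ≤⟨ +-monoʳ-≤ (hypCount F G u) (sum-mono-≤ (λ c → bound _ (pencil≢0 c))) ⟩
    hypCount F G u + ∑[ c < q ] a
      ≡⟨ cong (hypCount F G u +_) (sum-const q a) ⟩
    hypCount F G u + q * a ∎
    where open ≤-Reasoning

  common≤t : ∀ u v → Independent u v → common u v ≤ t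
  common≤t u v indep = *-cancelˡ-≤ q (+-cancelˡ-≤ n _ _ (begin
    n + q * common u v  ≤⟨ pencil≤ u v indep ⟩
    hypCount F G u + q * a ≤⟨ +-monoˡ-≤ (q * a) (bound u (proj₁ indep)) ⟩
    a + q * a           ≡⟨ balance ⟩
    n + q * t           ∎))
    where open ≤-Reasoning

  t≤common⇒maximal : ∀ u v → Independent u v → t ≤ common u v → hypCount F G u ≡ a
  t≤common⇒maximal u v indep t≤common = ≤-antisym (bound u (proj₁ indep)) (+-cancelʳ-≤ (q * a) _ _ (begin
    a + q * a          ≡⟨ balance ⟩
    n + q * t          ≤⟨ +-monoʳ-≤ n (*-monoʳ-≤ q t≤common) ⟩
    n + q * common u v ≤⟨ pencil≤ u v indep ⟩
    hypCount F G u + q * a ∎))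
    where open ≤-Reasoning

  length≤t : ∀ L → Distinct L → q < ∑V k (through L) → length L ≤ t
  length≤t L L-distinct q<A =
    let (u , u∈A , u≢0) = ∃-nonzero L q<A
        (v , v∈A , pencil≢0) = ∃-independent L q<A u
    in ≤-trans (length≤common L u v L-distinct u∈A v∈A) (common≤t u v (u≢0 , pencil≢0))

  through⇒maximal : ∀ L → Distinct L → length L ≡ t → q < ∑V k (through L) →
                    ∀ u → NonZeroVec F u → through L u ≡ 1 → hypCount F G u ≡ a
  through⇒maximal L L-distinct refl q<A u u≢0 u∈A =
    let (v , v∈A , pencil≢0) = ∃-independent L q<A u
    in t≤common⇒maximal u v (u≢0 , pencil≢0) (length≤common L u v L-distinct u∈A v∈A)

  maximal : V k → ℕ
  maximal u = 𝟙 (hypCount F G u ≟ℕ a)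

  maximalThrough : List (Fin n) → V k → ℕ
  maximalThrough L u = maximal u * through L u

  maximalThrough-ext : ∀ L → Extensional (maximalThrough L)
  maximalThrough-ext L u≗w = cong₂ _*_ (cong (λ z → 𝟙 (z ≟ℕ a)) (hypCount-ext u≗w)) (through-ext L u≗w)

  maximalThrough-scale : ∀ L → ScaleInvariant (maximalThrough L)
  maximalThrough-scale L c c≢0 u =
    cong₂ _*_ (cong (λ z → 𝟙 (z ≟ℕ a)) (hypCount-scale c c≢0 u)) (through-scale L c c≢0 u)

  -- The paper's γ_j for the j points L: each maximal hyperplane through L is counted once,
  -- by its normalised normal vector.
  γ-weight : List (Fin n) → V k → ℕ
  γ-weight L u = isNormalised u * maximalThrough L u

  γ : List (Fin n) → ℕ
  γ L = ∑V k (γ-weight L)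

  γ-double-count : ∀ L → Distinct L →
                   ∑[ j < n ] ((1 ∸ occurrences j L) * γ (j ∷ L)) ≡ γ L * (a ∸ length L)
  γ-double-count L L-distinct = sym (begin
    γ L * (a ∸ length L)
      ≡⟨ *-comm (γ L) _ ⟩
    (a ∸ length L) * γ L
      ≡⟨ ∑V-*ˡ (a ∸ length L) (γ-weight L) ⟨
    ∑V k (λ u → (a ∸ length L) * γ-weight L u)
      ≡⟨ ∑V-cong {k} pointwise ⟩
    ∑V k (λ u → ∑[ j < n ] ((1 ∸ occurrences j L) * γ-weight (j ∷ L) u))
      ≡⟨ ∑V-comm (λ j u → (1 ∸ occurrences j L) * γ-weight (j ∷ L) u) ⟩
    ∑[ j < n ] ∑V k (λ u → (1 ∸ occurrences j L) * γ-weight (j ∷ L) u)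
      ≡⟨ sum-cong-≗ {n} (λ j → ∑V-*ˡ (1 ∸ occurrences j L) (γ-weight (j ∷ L))) ⟩
    ∑[ j < n ] ((1 ∸ occurrences j L) * γ (j ∷ L)) ∎)
    where
    open ≡-Reasoning
    newPoints : ∀ u → 0 < γ-weight L u → a ∸ length L ≡ ∑[ j < n ] ((1 ∸ occurrences j L) * onHyp j u)
    newPoints u w>0 =
      let (u-max , u∈A) = *>0⇒ (maximal u) _ (proj₂ (*>0⇒ (isNormalised u) _ w>0))
      in trans (cong (_∸ length L) (trans (sym (𝟙>0⇒ (hypCount F G u ≟ℕ a) u-max))
                                          (hypCount-split L u L-distinct (≤1∧>0⇒≡1 (through≤1 L u) u∈A))))
               (m+n∸m≡n (length L) _)
    pointwise : ∀ u → (a ∸ length L) * γ-weight L u ≡ ∑[ j < n ] ((1 ∸ occurrences j L) * γ-weight (j ∷ L) u)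
    pointwise u = begin
      (a ∸ length L) * γ-weight L u
        ≡⟨ *-comm _ (γ-weight L u) ⟩
      γ-weight L u * (a ∸ length L)
        ≡⟨ *-congˡ-if>0 (γ-weight L u) (newPoints u) ⟩
      γ-weight L u * ∑[ j < n ] ((1 ∸ occurrences j L) * onHyp j u)
        ≡⟨ sum-*ˡ (γ-weight L u) (λ j → (1 ∸ occurrences j L) * onHyp j u) ⟨
      ∑[ j < n ] (γ-weight L u * ((1 ∸ occurrences j L) * onHyp j u))
        ≡⟨ sum-cong-≗ {n} (λ j → rearrange (isNormalised u) (maximal u) (through L u)
                                            (1 ∸ occurrences j L) (onHyp j u)) ⟩
      ∑[ j < n ] ((1 ∸ occurrences j L) * γ-weight (j ∷ L) u) ∎
      where
      rearrange : ∀ x y z m h → x * (y * z) * (m * h) ≡ m * (x * (y * (h * z)))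
      rearrange = solve-∀

  module _ (k≡2+t : k ≡ 2 + t) (t<n : t < n) where

    t≤a : t ≤ a
    t≤a = *-cancelˡ-≤ (suc q) (begin
      t + q * t ≤⟨ +-monoˡ-≤ (q * t) (<⇒≤ t<n) ⟩
      n + q * t ≡⟨ balance ⟨
      a + q * a ∎)
      where open ≤-Reasoning

    ∑V-through≡q² : ∀ L → Distinct L → length L ≡ t → ∑V k (through L) ≡ q * q
    ∑V-through≡q² L L-distinct L-length = ≤-antisym upper lower
      where
      i∉L : ∃ λ i → occurrences i L ≡ 0
      i∉L = fresh L (subst (_< n) (sym L-length) t<n)
      i : Fin n
      i = proj₁ i∉L
      ∑V-through-∷≤q : ∑V k (through (i ∷ L)) ≤ q
      ∑V-through-∷≤q = ≮⇒≥ λ q<A → <-irrefl refl (subst (_≤ t) (cong suc L-length)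
        (length≤t (i ∷ L) (Distinct-∷ {L = L} L-distinct (proj₂ i∉L)) q<A))
      upper : ∑V k (through L) ≤ q * q
      upper = ≤-trans (∑V-through≤q*∑V-through-∷ L i) (*-monoʳ-≤ q ∑V-through-∷≤q)
      instance
        q^t≢0 : NonZero (q ^ t)
        q^t≢0 = m^n≢0 q t
      lower : q * q ≤ ∑V k (through L)
      lower = *-cancelʳ-≤ (q * q) _ (q ^ t) (begin
        q * q * q ^ t                    ≡⟨ *-assoc q q _ ⟩
        q ^ (2 + t)                      ≡⟨ cong (q ^_) k≡2+t ⟨
        q ^ k                            ≤⟨ q^k≤∑V-through*q^length L ⟩
        ∑V k (through L) * q ^ length L  ≡⟨ cong (λ ℓ → ∑V k (through L) * q ^ ℓ) L-length ⟩
        ∑V k (through L) * q ^ t         ∎)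
        where open ≤-Reasoning

    -- The q * q normals through t points are 0 and, for each of the γ maximal hyperplanes
    -- through them, its q - 1 nonzero normals.
    γ≡1+q : ∀ L → Distinct L → length L ≡ t → γ L ≡ 1 + q
    γ≡1+q L L-distinct L-length = q²≡1+[q∸1]*n⇒n≡1+q q (γ L) 2≤q (begin
      q * q
        ≡⟨ ∑V-through≡q² L L-distinct L-length ⟨
      ∑V k (through L)
        ≡⟨ ∑V-split-isZero (through L) ⟩
      ∑V k (λ u → isZero u * through L u) + ∑V k (λ u → isNonZero u * through L u)
        ≡⟨ cong₂ _+_ (∑V-isZero*through L) (∑V-cong {k} nonzero⇒maximal) ⟩
      1 + ∑V k (λ u → isNonZero u * maximalThrough L u)
        ≡⟨ cong suc (∑V-isNonZero≡[q∸1]*∑V-isNormalised k (maximalThrough L)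
                       (maximalThrough-ext L) (maximalThrough-scale L)) ⟩
      1 + (q ∸ 1) * γ L ∎)
      where
      open ≡-Reasoning
      q<A : q < ∑V k (through L)
      q<A = subst (q <_) (sym (∑V-through≡q² L L-distinct L-length)) (m<m*n q q 2≤q)
      nonzero⇒maximal : ∀ u → isNonZero u * through L u ≡ isNonZero u * maximalThrough L u
      nonzero⇒maximal u with n≤1⇒n≡0∨n≡1 (through≤1 L u)
      ... | inj₁ u∉A rewrite u∉A = cong (isNonZero u *_) (sym (*-zeroʳ (maximal u)))
      ... | inj₂ u∈A rewrite u∈A = *-congˡ-if>0 (isNonZero u) λ u≢0 → sym (trans (*-identityʳ _)
              (𝟙-yes (hypCount F G u ≟ℕ a) (through⇒maximal L L-distinct L-length q<A u
                (isZero≡0⇒NonZeroVec u (isNonZero>0⇒isZero≡0 u u≢0)) u∈A)))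

    γ*C≡C : ∀ r L → Distinct L → length L + suc r ≡ suc t →
            γ L * ((a ∸ length L) C suc r) ≡ (n ∸ length L) C suc r
    γ*C≡C zero L L-distinct ℓ+1≡1+t = begin
      γ L * ((a ∸ length L) C 1) ≡⟨ cong₂ _*_ (γ≡1+q L L-distinct L-length) (nC1≡n _) ⟩
      suc q * (a ∸ length L)     ≡⟨ cong (λ ℓ → suc q * (a ∸ ℓ)) L-length ⟩
      suc q * (a ∸ t)            ≡⟨ [1+q]*[a∸t]≡n∸t q a n t balance ⟩
      n ∸ t                      ≡⟨ cong (n ∸_) L-length ⟨
      n ∸ length L               ≡⟨ nC1≡n _ ⟨
      (n ∸ length L) C 1         ∎
      where
      open ≡-Reasoning
      L-length : length L ≡ t
      L-length = suc-injective (trans (+-comm 1 (length L)) ℓ+1≡1+t)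
    γ*C≡C (suc r) L L-distinct ℓ+2+r≡1+t = *-cancelˡ-≡ _ _ (suc (suc r)) (begin
      suc (suc r) * (γ L * ((a ∸ ℓ) C suc (suc r)))       ≡⟨ x∙yz≈y∙xz (suc (suc r)) (γ L) _ ⟩
      γ L * (suc (suc r) * ((a ∸ ℓ) C suc (suc r)))       ≡⟨ cong (γ L *_) (C-absorption-∸ (suc r) ℓ<a) ⟩
      γ L * ((a ∸ ℓ) * Cₐ)                                ≡⟨ *-assoc (γ L) _ Cₐ ⟨
      γ L * (a ∸ ℓ) * Cₐ                                  ≡⟨ cong (_* Cₐ) (γ-double-count L L-distinct) ⟨
      ∑[ j < n ] ((1 ∸ occurrences j L) * γ (j ∷ L)) * Cₐ ≡⟨ extensions ⟩
      (n ∸ ℓ) * Cₙ                                        ≡⟨ C-absorption-∸ (suc r) ℓ<n ⟨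
      suc (suc r) * ((n ∸ ℓ) C suc (suc r))               ∎)
      where
      open ≡-Reasoning
      open CommutativeSemigroupProperties *-commutativeSemigroup using (x∙yz≈y∙xz)
      ℓ Cₐ Cₙ : ℕ
      ℓ  = length L
      Cₐ = (a ∸ suc ℓ) C suc r
      Cₙ = (n ∸ suc ℓ) C suc r
      ℓ+1+r≡t : ℓ + suc r ≡ t
      ℓ+1+r≡t = suc-injective (trans (sym (+-suc ℓ (suc r))) ℓ+2+r≡1+t)
      ℓ<t : ℓ < t
      ℓ<t = subst (ℓ <_) ℓ+1+r≡t (m<m+n ℓ (s≤s z≤n))
      ℓ<a : ℓ < a
      ℓ<a = ≤-trans ℓ<t t≤a
      ℓ<n : ℓ < n
      ℓ<n = <-trans ℓ<t t<n
      extend : ∀ j → (1 ∸ occurrences j L) * γ (j ∷ L) * Cₐ ≡ (1 ∸ occurrences j L) * Cₙ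
      extend j with n≤1⇒n≡0∨n≡1 (L-distinct j)
      ... | inj₂ j∈L rewrite j∈L = refl
      ... | inj₁ j∉L rewrite j∉L = trans (cong (_* Cₐ) (+-identityʳ (γ (j ∷ L))))
          (trans (γ*C≡C r (j ∷ L) (Distinct-∷ {L = L} L-distinct j∉L) (cong suc ℓ+1+r≡t))
                 (sym (+-identityʳ Cₙ)))
      extensions : ∑[ j < n ] ((1 ∸ occurrences j L) * γ (j ∷ L)) * Cₐ ≡ (n ∸ ℓ) * Cₙ
      extensions = begin
        ∑[ j < n ] ((1 ∸ occurrences j L) * γ (j ∷ L)) * Cₐ
          ≡⟨ *-distribʳ-sum Cₐ (λ j → (1 ∸ occurrences j L) * γ (j ∷ L)) ⟩
        ∑[ j < n ] ((1 ∸ occurrences j L) * γ (j ∷ L) * Cₐ)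
          ≡⟨ sum-cong-≗ {n} extend ⟩
        ∑[ j < n ] ((1 ∸ occurrences j L) * Cₙ)
          ≡⟨ *-distribʳ-sum Cₙ (λ j → 1 ∸ occurrences j L) ⟨
        ∑[ j < n ] (1 ∸ occurrences j L) * Cₙ
          ≡⟨ cong (_* Cₙ) (∑-complement L L-distinct) ⟩
        (n ∸ ℓ) * Cₙ ∎

    C∣C : ∀ j → j ≤ t → ((a ∸ j) C (suc t ∸ j)) ∣ ((n ∸ j) C (suc t ∸ j))
    C∣C j j≤t with distinctOfLength j (≤-trans j≤t (<⇒≤ t<n))
    ... | L , L-distinct , refl = divides (γ L) (begin
      (n ∸ ℓ) C (suc t ∸ ℓ)         ≡⟨ cong ((n ∸ ℓ) C_) 1+t∸ℓ ⟩
      (n ∸ ℓ) C suc (t ∸ ℓ)         ≡⟨ γ*C≡C (t ∸ ℓ) L L-distinct ℓ+1+[t∸ℓ]≡1+t ⟨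
      γ L * ((a ∸ ℓ) C suc (t ∸ ℓ)) ≡⟨ cong (λ x → γ L * ((a ∸ ℓ) C x)) 1+t∸ℓ ⟨
      γ L * ((a ∸ ℓ) C (suc t ∸ ℓ)) ∎)
      where
      open ≡-Reasoning
      ℓ : ℕ
      ℓ = length L
      1+t∸ℓ : suc t ∸ ℓ ≡ suc (t ∸ ℓ)
      1+t∸ℓ = +-∸-assoc 1 j≤t
      ℓ+1+[t∸ℓ]≡1+t : ℓ + suc (t ∸ ℓ) ≡ suc t
      ℓ+1+[t∸ℓ]≡1+t = trans (+-suc ℓ (t ∸ ℓ)) (cong suc (m+[n∸m]≡n j≤t))

mainTheorem7 : (q k n d s : ℕ) (F : FiniteField q) (G : ProjSystem F n k) →
    3 ≤ k →
    NonDegenerate F G →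
    HasMinDist F G d →
    n + 1 ≡ k + d + s →
    n ≡ (s + 1) * (q + 1) + k ∸ 2 →
    (j : ℕ) → j ≤ k ∸ 2 →
    ((n ∸ d ∸ j) C (k ∸ 1 ∸ j)) ∣ ((n ∸ j) C (k ∸ 1 ∸ j))
mainTheorem7 q zero          n d s F G ()
mainTheorem7 q (suc zero)    n d s F G (s≤s ())
mainTheorem7 q (suc (suc t)) n d s F (G , _) _ _ (hyperplane≤n∸d , _) n+1≡k+d+s n≡ =
  Extremal.C∣C F G (n ∸ d) t bound balance refl t<n
  where
  n≡1+t+s+d : n ≡ suc (t + s) + d
  n≡1+t+s+d = +-cancelʳ-≡ 1 n _ (trans n+1≡k+d+s (rearrange t d s))
    where
    rearrange : ∀ t d s → suc (suc t) + d + s ≡ suc (t + s) + d + 1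
    rearrange = solve-∀
  t<n : t < n
  t<n = subst (t <_) (sym n≡1+t+s+d) (s≤s (≤-trans (m≤m+n t s) (m≤m+n (t + s) d)))
  bound : ∀ u → NonZeroVec F u → hypCount F G u ≤ n ∸ d
  bound u u≢0 = m+n≤o⇒m≤o∸n (hypCount F G u) (hyperplane≤n∸d u u≢0)
  balance : n ∸ d + q * (n ∸ d) ≡ n + q * t
  balance = begin
    n ∸ d + q * (n ∸ d)            ≡⟨ cong (λ a → a + q * a) n∸d≡1+t+s ⟩
    suc (t + s) + q * suc (t + s)  ≡⟨ expand t s q ⟩
    (s + 1) * (q + 1) + t + q * t  ≡⟨ cong (_+ q * t) n≡[s+1][q+1]+t ⟨
    n + q * t                      ∎
    where
    open ≡-Reasoning
    n∸d≡1+t+s : n ∸ d ≡ suc (t + s)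
    n∸d≡1+t+s = trans (cong (_∸ d) n≡1+t+s+d) (m+n∸n≡m _ d)
    n≡[s+1][q+1]+t : n ≡ (s + 1) * (q + 1) + t
    n≡[s+1][q+1]+t = trans n≡ (+-∸-assoc ((s + 1) * (q + 1)) (s≤s (s≤s z≤n)))
    expand : ∀ t s q → suc (t + s) + q * suc (t + s) ≡ (s + 1) * (q + 1) + t + q * t
    expand = solve-∀
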